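{- Let $n\ge1$, $s\ge2$ and $0\le w\le n(s-1)$. The map $f:[s]^n\to[s]^n$ defined by \[ f_i(x)=\mathrm{saturation}\Big(w-\sum_{j\ne i}x_j\Big)\qquad(i\in[n]) \] belongs to $F(K_n^-,s)$ and its set of fixed points is exactly $B(n,w,s)$. However, for any $w$ with $s-1\le w\le(n-1)(s-1)$, no function in $F(K_n^-,s)$ converges to $B(n,w,s)$; in particular, for $n\ge2$ no function in $F(K_n^-,s)$ converges to $B(n,\lfloor n(s-1)/2\rfloor,s)$.
   Context: $K_n^-$ is the signed digraph on $[n]=\{0,\dots,n-1\}$ without loops having an arc $(j,i)$ for every ordered pair $j\ne i$, each signed $-1$. For $[s]=\{0,\dots,s-1\}$, $F(K_n^-,s)$ is the set of maps $f:[s]^n\to[s]^n$ such that each $f_i$ does not depend on $x_i$ and is non-increasing in every other coordinate. For $x\in[s]^n$, $W(x)=\sum_ix_i$ and $B(n,w,s)=\{x\in[s]^n:W(x)=w\}$. $\mathrm{saturation}:\mathbb Z\to[s]$ maps $a<0$ to $0$, $a\in[s]$ to $a$, and $a>s-1$ to $s-1$. A map $f$ converges to a set $S\subseteq[s]^n$ if every element of $S$ is a fixed point of $f$ and for every $x\in[s]^n$ there exists a positive integer $k$ with $f^k(x)\in S$. -}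

module Defs where

open import Data.Nat using (ℕ; zero; suc; _+_; _≤?_; NonZero; s≤s)
open import Data.Integer using (ℤ; +_; -[1+_]; _-_)
open import Data.Fin using (Fin; toℕ; fromℕ; fromℕ<; _≟_) renaming (_≤_ to _≤ᶠ_)
open import Data.Product using (_×_; Σ)
open import Function using (_⇔_)
open import Relation.Nullary using (¬_; yes; no)
open import Relation.Binary.PropositionalEquality using (_≡_; _≢_)

Conf : ℕ → ℕ → Set
Conf n s = Fin n → Fin s

sumFin : ∀ {n} → (Fin n → ℕ) → ℕ
sumFin {zero}  g = 0
sumFin {suc n} g = g Fin.zero + sumFin (λ i → g (Fin.suc i))

W : ∀ {n s} → Conf n s → ℕ
W x = sumFin (λ i → toℕ (x i))

sumExcept : ∀ {n s} → Conf n s → Fin n → ℕ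
sumExcept x i = sumFin (λ j → f j)
  where
  f : _ → ℕ
  f j with j ≟ i
  ... | yes _ = 0
  ... | no  _ = toℕ (x j)

saturation : ∀ {s} .{{_ : NonZero s}} → ℤ → Fin s
saturation {suc k} -[1+ _ ] = Fin.zero
saturation {suc k} (+ m) with m ≤? k
... | yes m≤k = fromℕ< (s≤s m≤k)
... | no  _   = fromℕ k

satMap : ∀ n s .{{_ : NonZero s}} → ℕ → Conf n s → Conf n s
satMap n s w x i = saturation ((+ w) - (+ sumExcept x i))

-- F(K_n^-, s): f_i does not depend on x_i, and is non-increasing in each x_j, j ≠ i
InF : ∀ n s → (Conf n s → Conf n s) → Set
InF n s f =
  (∀ i (x y : Conf n s) → (∀ j → j ≢ i → x j ≡ y j) → f x i ≡ f y i)
  × (∀ i j → j ≢ i → (x y : Conf n s) → (∀ k → k ≢ j → x k ≡ y k) →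
       x j ≤ᶠ y j → f y i ≤ᶠ f x i)

B : ∀ n s → ℕ → Conf n s → Set
B n s w x = W x ≡ w

IsFixed : ∀ {n s} → (Conf n s → Conf n s) → Conf n s → Set
IsFixed f x = ∀ i → f x i ≡ x i

iter : ∀ {A : Set} → (A → A) → ℕ → A → A
iter f zero    a = a
iter f (suc k) a = f (iter f k a)

-- f converges to S: every element of S is fixed, and every x reaches S
-- after a positive number of steps
ConvergesTo : ∀ {n s} → (Conf n s → Conf n s) → (Conf n s → Set) → Set
ConvergesTo f S =
  (∀ x → S x → IsFixed f x) × (∀ x → Σ ℕ λ k → S (iter f (suc k) x))

-- Write K = s-1 and S_i(x) = Σ_{j≠i} x_j, so that W(x) = x_i + S_i(x).
--
-- Part 1.  The saturation map is f_i(x) = min(w ∸ S_i(x), K).  It ignores x_i and is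
-- antitone because S_i is monotone.  If W(x) = w then f_i(x) = min(x_i, K) = x_i.
-- Conversely, at a fixed point W(x) > w forces every coordinate to be clamped to 0
-- (so W(x) = 0), and W(x) < w forces every coordinate to be clamped to K (so
-- W(x) = nK ≥ w); both are absurd.
--
-- Part 2.  Every f ∈ F(K_n^-,s) is antitone for the product order (walk from x to y
-- changing one coordinate at a time).  If f fixes B, then for each i there are
-- points of B with x_i = K and with x_i = 0; comparing them with the constant
-- configurations 0 and K shows that f swaps these two.  So the orbit of 0
-- alternates between weights 0 < w and nK > w and never meets B.
--
-- Part 3.  For n ≥ 2 the middle weight ⌊nK/2⌋ lies between K and (n-1)K.
module Submission where

open import Defs
open import Data.Nat using (ℕ; zero; suc; _+_; _*_; _∸_; _≤_; _<_; _⊓_; _≤?_; _<?_; z≤n; s≤s; NonZero)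
open import Data.Nat.Properties hiding (_≟_; suc-injective)
open import Data.Nat.DivMod using (_/_; m*n/n≡m; /-monoˡ-≤)
import Data.Integer as ℤ
open import Data.Integer.Properties using (m-n≡m⊖n; ⊖-≥; ⊖-<)
open import Data.Fin using (Fin; toℕ; fromℕ; fromℕ<; _≟_) renaming (_≤_ to _≤ᶠ_)
open import Data.Fin.Properties using (toℕ-fromℕ; toℕ-fromℕ<; toℕ<n; toℕ≤pred[n]; toℕ-injective; suc-injective)
open import Data.Vec.Functional using (insertAt; tail; _∷_)
open import Data.Vec.Functional.Properties using (insertAt-lookup)
open import Data.Product using (_×_; Σ; _,_; proj₁; proj₂)
open import Data.Sum using (_⊎_; inj₁; inj₂)
open import Data.Empty using (⊥-elim)
open import Function using (_⇔_; mk⇔; _∘_)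
open import Relation.Nullary using (¬_; yes; no)
open import Relation.Binary using (tri<; tri≈; tri>)
open import Relation.Binary.PropositionalEquality
open import Algebra.Properties.CommutativeSemigroup +-commutativeSemigroup using (x∙yz≈y∙xz)

sumFin-cong : ∀ {n} {g h : Fin n → ℕ} → (∀ j → g j ≡ h j) → sumFin g ≡ sumFin h
sumFin-cong {zero}  e = refl
sumFin-cong {suc n} e = cong₂ _+_ (e Fin.zero) (sumFin-cong (λ j → e (Fin.suc j)))

sumFin-mono : ∀ {n} {g h : Fin n → ℕ} → (∀ j → g j ≤ h j) → sumFin g ≤ sumFin h
sumFin-mono {zero}  le = z≤n
sumFin-mono {suc n} le = +-mono-≤ (le Fin.zero) (sumFin-mono (λ j → le (Fin.suc j)))

sumFin-const : ∀ n c → sumFin {n} (λ _ → c) ≡ n * c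
sumFin-const zero    c = refl
sumFin-const (suc n) c = cong (c +_) (sumFin-const n c)

sumFin-remove : ∀ {n} (g h : Fin n → ℕ) (i : Fin n) →
                h i ≡ 0 → (∀ j → j ≢ i → h j ≡ g j) → sumFin g ≡ g i + sumFin h
sumFin-remove {suc n} g h Fin.zero h-i h-off =
  cong (g Fin.zero +_) (cong₂ _+_ (sym h-i) (sumFin-cong (λ j → sym (h-off (Fin.suc j) λ ()))))
sumFin-remove {suc n} g h (Fin.suc i) h-i h-off = begin
    g Fin.zero + sumFin (tail g)
  ≡⟨ cong (g Fin.zero +_) (sumFin-remove (tail g) (tail h) i h-i (λ j j≢i → h-off (Fin.suc j) (j≢i ∘ suc-injective))) ⟩
    g Fin.zero + (g (Fin.suc i) + sumFin (tail h))
  ≡⟨ x∙yz≈y∙xz (g Fin.zero) (g (Fin.suc i)) (sumFin (tail h)) ⟩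
    g (Fin.suc i) + (g Fin.zero + sumFin (tail h))
  ≡⟨ cong (λ a → g (Fin.suc i) + (a + sumFin (tail h))) (sym (h-off Fin.zero λ ())) ⟩
    g (Fin.suc i) + sumFin h
  ∎
  where open ≡-Reasoning

W-const : ∀ {n s} (x : Conf n s) c → (∀ i → toℕ (x i) ≡ c) → W x ≡ n * c
W-const {n} x c xc = trans (sumFin-cong xc) (sumFin-const n c)

-- The summand of a sum, recovered from the sum by unification.  Defs defines the
-- summand of sumExcept in a local where-block; this lets us name it.
summandOf : ∀ {n} (t : ℕ) {g : Fin n → ℕ} → t ≡ sumFin g → Fin n → ℕ
summandOf _ {g} _ = g

-- exceptTerm x i j = x_j if j ≢ i and 0 if j ≡ i (definitionally the summand of S_i).
exceptTerm : ∀ {n s} → Conf n s → Fin n → Fin n → ℕ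
exceptTerm x i = summandOf (sumExcept x i) refl

exceptTerm-self : ∀ {n s} (x : Conf n s) i → exceptTerm x i i ≡ 0
exceptTerm-self x i with i ≟ i
... | yes _   = refl
... | no i≢i = ⊥-elim (i≢i refl)

exceptTerm-other : ∀ {n s} (x : Conf n s) {i j} → j ≢ i → exceptTerm x i j ≡ toℕ (x j)
exceptTerm-other x {i} {j} j≢i with j ≟ i
... | yes j≡i = ⊥-elim (j≢i j≡i)
... | no  _   = refl

W-split : ∀ {n s} (x : Conf n s) i → W x ≡ toℕ (x i) + sumExcept x i
W-split x i = sumFin-remove _ (exceptTerm x i) i (exceptTerm-self x i) (λ j → exceptTerm-other x)

sumExcept-local : ∀ {n s} (x y : Conf n s) i → (∀ j → j ≢ i → x j ≡ y j) →
                  sumExcept x i ≡ sumExcept y i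
sumExcept-local x y i agree = sumFin-cong termwise
  where
  termwise : ∀ j → exceptTerm x i j ≡ exceptTerm y i j
  termwise j with j ≟ i
  ... | yes _   = refl
  ... | no  j≢i = cong toℕ (agree j j≢i)

sumExcept-mono : ∀ {n s} (x y : Conf n s) i → (∀ j → x j ≤ᶠ y j) →
                 sumExcept x i ≤ sumExcept y i
sumExcept-mono x y i le = sumFin-mono termwise
  where
  termwise : ∀ j → exceptTerm x i j ≤ exceptTerm y i j
  termwise j with j ≟ i
  ... | yes _ = z≤n
  ... | no  _ = le j

saturation-nonneg : ∀ K m → toℕ (saturation {suc K} (ℤ.+ m)) ≡ m ⊓ K
saturation-nonneg K m with m ≤? K
... | yes m≤K = trans (toℕ-fromℕ< (s≤s m≤K)) (sym (m≤n⇒m⊓n≡m m≤K))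
... | no  m≰K = trans (toℕ-fromℕ K) (sym (m≥n⇒m⊓n≡n (≰⇒≥ m≰K)))

saturation-neg : ∀ K m → 0 < m → saturation {suc K} (ℤ.- ℤ.+ m) ≡ Fin.zero
saturation-neg K (suc m) _ = refl

saturation-diff : ∀ K w S → toℕ (saturation {suc K} (ℤ.+ w ℤ.- ℤ.+ S)) ≡ (w ∸ S) ⊓ K
saturation-diff K w S with S ≤? w
... | yes S≤w = begin
    toℕ (saturation (ℤ.+ w ℤ.- ℤ.+ S)) ≡⟨ cong (toℕ ∘ saturation) (trans (m-n≡m⊖n w S) (⊖-≥ S≤w)) ⟩
    toℕ (saturation (ℤ.+ (w ∸ S)))     ≡⟨ saturation-nonneg K (w ∸ S) ⟩
    (w ∸ S) ⊓ K                        ∎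
  where open ≡-Reasoning
... | no  S≰w = begin
    toℕ (saturation (ℤ.+ w ℤ.- ℤ.+ S)) ≡⟨ cong (toℕ ∘ saturation) (trans (m-n≡m⊖n w S) (⊖-< w<S)) ⟩
    toℕ (saturation (ℤ.- ℤ.+ (S ∸ w))) ≡⟨ cong toℕ (saturation-neg K (S ∸ w) (m<n⇒0<n∸m w<S)) ⟩
    0                                  ≡⟨ cong (_⊓ K) (sym (m≤n⇒m∸n≡0 (<⇒≤ w<S))) ⟩
    (w ∸ S) ⊓ K                        ∎
  where
  open ≡-Reasoning
  w<S : w < S
  w<S = ≰⇒> S≰w

clamp-overshoot : ∀ {a S w K} → a ≡ (w ∸ S) ⊓ K → w < a + S → a ≡ 0
clamp-overshoot {a} {S} {w} {K} a≡ w<a+S with S ≤? w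
... | yes S≤w = ⊥-elim (<⇒≱ w<a+S (begin
      a + S       ≤⟨ +-monoˡ-≤ S (≤-trans (≤-reflexive a≡) (m⊓n≤m (w ∸ S) K)) ⟩
      w ∸ S + S   ≡⟨ m∸n+n≡m S≤w ⟩
      w           ∎))
  where open ≤-Reasoning
... | no  S≰w = n≤0⇒n≡0 (begin
      a           ≤⟨ ≤-trans (≤-reflexive a≡) (m⊓n≤m (w ∸ S) K) ⟩
      w ∸ S       ≡⟨ m≤n⇒m∸n≡0 (<⇒≤ (≰⇒> S≰w)) ⟩
      0           ∎)
  where open ≤-Reasoning

clamp-undershoot : ∀ {a S w K} → a ≡ (w ∸ S) ⊓ K → a + S < w → a ≡ K
clamp-undershoot {a} {S} {w} {K} a≡ a+S<w with ⊓-sel (w ∸ S) K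
... | inj₁ min≡w∸S = ⊥-elim (<-irrefl (trans a≡ min≡w∸S) (m+n≤o⇒m≤o∸n (suc a) a+S<w))
... | inj₂ min≡K   = trans a≡ min≡K

clamp-exact : ∀ {a S w K} → a ≤ K → a + S ≡ w → (w ∸ S) ⊓ K ≡ a
clamp-exact {a} {S} {w} {K} a≤K a+S≡w =
  trans (cong (_⊓ K) (trans (cong (_∸ S) (sym a+S≡w)) (m+n∸n≡m a S))) (m≤n⇒m⊓n≡m a≤K)

_≤ᶜ_ : ∀ {n s} → Conf n s → Conf n s → Set
x ≤ᶜ y = ∀ j → x j ≤ᶠ y j

single-change : ∀ {n s} {x y : Conf n s} j → (∀ k → k ≢ j → x k ≡ y k) → x j ≤ᶠ y j → x ≤ᶜ y
single-change j agree le k with k ≟ j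
... | yes refl = le
... | no  k≢j  = ≤-reflexive (cong toℕ (agree k k≢j))

module SaturationMap (n K w : ℕ) where

  sat : Conf n (suc K) → Conf n (suc K)
  sat = satMap n (suc K) w

  sat-value : ∀ x i → toℕ (sat x i) ≡ (w ∸ sumExcept x i) ⊓ K
  sat-value x i = saturation-diff K w (sumExcept x i)

  sat-antitone : ∀ x y → x ≤ᶜ y → ∀ i → sat y i ≤ᶠ sat x i
  sat-antitone x y x≤y i = subst₂ _≤_ (sym (sat-value y i)) (sym (sat-value x i))
    (⊓-monoˡ-≤ K (∸-monoʳ-≤ w (sumExcept-mono x y i x≤y)))

  sat∈F : InF n (suc K) sat
  sat∈F = (λ i x y agree → cong (λ S → saturation (ℤ.+ w ℤ.- ℤ.+ S)) (sumExcept-local x y i agree))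
        , (λ i j _ x y agree le → sat-antitone x y (single-change j agree le) i)

  -- On B, w ∸ S_i(x) = x_i ≤ K, so nothing is clamped.
  B⇒fixed : ∀ x → W x ≡ w → IsFixed sat x
  B⇒fixed x W≡w i = toℕ-injective
    (trans (sat-value x i) (clamp-exact (toℕ≤pred[n] (x i)) (trans (sym (W-split x i)) W≡w)))

  fixed-clamped : ∀ x → IsFixed sat x → ∀ i → toℕ (x i) ≡ (w ∸ sumExcept x i) ⊓ K
  fixed-clamped x fixed i = trans (cong toℕ (sym (fixed i))) (sat-value x i)

  -- At a fixed point with W(x) ≠ w all coordinates are clamped to the same end.
  fixed⇒B : w ≤ n * K → ∀ x → IsFixed sat x → W x ≡ w
  fixed⇒B w≤nK x fixed with <-cmp (W x) w
  ... | tri≈ _ W≡w _ = W≡w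
  ... | tri< W<w _ _ = ⊥-elim (<⇒≱ W<w (subst (w ≤_) (sym (W-const x K all-K)) w≤nK))
    where
    all-K : ∀ i → toℕ (x i) ≡ K
    all-K i = clamp-undershoot (fixed-clamped x fixed i) (subst (_< w) (W-split x i) W<w)
  ... | tri> _ _ w<W = ⊥-elim (n≮0 (subst (w <_) (trans (W-const x 0 all-0) (*-zeroʳ n)) w<W))
    where
    all-0 : ∀ i → toℕ (x i) ≡ 0
    all-0 i = clamp-overshoot (fixed-clamped x fixed i) (subst (w <_) (W-split x i) w<W)

-- hybrid x y k agrees with y on the coordinates j < k and with x on the others;
-- it interpolates between x (k = 0) and y (k = n) one coordinate at a time.
hybrid : ∀ {n s} → Conf n s → Conf n s → ℕ → Conf n s
hybrid x y k j with toℕ j <? k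
... | yes _ = y j
... | no  _ = x j

hybrid-below : ∀ {n s} (x y : Conf n s) {k} j → toℕ j < k → hybrid x y k j ≡ y j
hybrid-below x y {k} j j<k with toℕ j <? k
... | yes _   = refl
... | no  j≮k = ⊥-elim (j≮k j<k)

hybrid-above : ∀ {n s} (x y : Conf n s) {k} j → k ≤ toℕ j → hybrid x y k j ≡ x j
hybrid-above x y {k} j k≤j with toℕ j <? k
... | yes j<k = ⊥-elim (<⇒≱ j<k k≤j)
... | no  _   = refl

hybrid-step : ∀ {n s} (x y : Conf n s) {k} j → toℕ j ≢ k → hybrid x y (suc k) j ≡ hybrid x y k j
hybrid-step x y {k} j j≢k with toℕ j <? k
... | yes j<k = hybrid-below x y j (m≤n⇒m≤1+n j<k)
... | no  j≮k = hybrid-above x y j (≤∧≢⇒< (≮⇒≥ j≮k) (j≢k ∘ sym))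

module Antitone {n s} (f : Conf n s → Conf n s) (f∈F : InF n s f) where

  extensional : ∀ x y → (∀ j → x j ≡ y j) → ∀ i → f x i ≡ f y i
  extensional x y x≗y i = proj₁ f∈F i x y (λ j _ → x≗y j)

  single-step : ∀ j (x y : Conf n s) → (∀ k → k ≢ j → x k ≡ y k) → x j ≤ᶠ y j →
                ∀ i → f y i ≤ᶠ f x i
  single-step j x y agree x≤y i with j ≟ i
  ... | yes refl = ≤-reflexive (cong toℕ (sym (proj₁ f∈F j x y agree)))
  ... | no  j≢i  = proj₂ f∈F i j j≢i x y agree x≤y

  -- Walk from x to y through the hybrids, one coordinate per step.
  antitone : ∀ x y → x ≤ᶜ y → ∀ i → f y i ≤ᶠ f x i
  antitone x y x≤y i =
    subst (_≤ᶠ f x i) (extensional (hybrid x y n) y (λ j → hybrid-below x y j (toℕ<n j)) i) (walk n ≤-refl)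
    where
    walk : ∀ k → k ≤ n → f (hybrid x y k) i ≤ᶠ f x i
    walk zero    _   = ≤-reflexive (cong toℕ (extensional (hybrid x y 0) x (λ j → hybrid-above x y j z≤n) i))
    walk (suc k) k<n = ≤-trans (single-step j₀ (hybrid x y k) (hybrid x y (suc k)) agree moved i) (walk k (<⇒≤ k<n))
      where
      j₀ : Fin n
      j₀ = fromℕ< k<n
      agree : ∀ j → j ≢ j₀ → hybrid x y k j ≡ hybrid x y (suc k) j
      agree j j≢j₀ = sym (hybrid-step x y j (λ j≡k → j≢j₀ (toℕ-injective (trans j≡k (sym (toℕ-fromℕ< k<n))))))
      moved : hybrid x y k j₀ ≤ᶠ hybrid x y (suc k) j₀
      moved = subst₂ _≤ᶠ_ (sym (hybrid-above x y j₀ (≤-reflexive (sym (toℕ-fromℕ< k<n)))))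
                          (sym (hybrid-below x y j₀ (s≤s (≤-reflexive (toℕ-fromℕ< k<n)))))
                          (x≤y j₀)

-- Every weight m ≤ nK is attained in [K+1]^n (greedily: fill coordinates with K).
fill : ∀ n K m → m ≤ n * K → Σ (Conf n (suc K)) λ z → W z ≡ m
fill zero    K m m≤0 = (λ ()) , sym (n≤0⇒n≡0 m≤0)
fill (suc n) K m m≤  = (first ∷ proj₁ rest) , (begin
    toℕ first + W (proj₁ rest) ≡⟨ cong₂ _+_ (toℕ-fromℕ< (s≤s (m⊓n≤m K m))) (proj₂ rest) ⟩
    K ⊓ m + (m ∸ K)            ≡⟨ m⊓n+n∸m≡n K m ⟩
    m                          ∎)
  where
  open ≡-Reasoning
  first : Fin (suc K)
  first = fromℕ< (s≤s (m⊓n≤m K m))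
  rest : Σ (Conf n (suc K)) λ z → W z ≡ m ∸ K
  rest = fill n K (m ∸ K) (subst (m ∸ K ≤_) (m+n∸m≡n K (n * K)) (∸-monoˡ-≤ K m≤))

W-insertAt : ∀ {n s} (z : Conf n s) i (v : Fin s) → W (insertAt z i v) ≡ toℕ v + W z
W-insertAt z Fin.zero v = refl
W-insertAt {suc n} z (Fin.suc i) v = begin
    toℕ (z Fin.zero) + W (insertAt (tail z) i v) ≡⟨ cong (toℕ (z Fin.zero) +_) (W-insertAt (tail z) i v) ⟩
    toℕ (z Fin.zero) + (toℕ v + W (tail z))      ≡⟨ x∙yz≈y∙xz (toℕ (z Fin.zero)) (toℕ v) (W (tail z)) ⟩
    toℕ v + W z                                  ∎
  where open ≡-Reasoning

prescribed : ∀ {n K} (i : Fin (suc n)) (v : Fin (suc K)) m → m ≤ n * K →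
             Σ (Conf (suc n) (suc K)) λ y → y i ≡ v × W y ≡ toℕ v + m
prescribed {n} {K} i v m m≤nK with fill n K m m≤nK
... | z , Wz≡m = insertAt z i v , insertAt-lookup z i v , trans (W-insertAt z i v) (cong (toℕ v +_) Wz≡m)

orbit-alternates : ∀ {A : Set} (f : A → A) (P Q : A → Set) →
                   (∀ a → P a → Q (f a)) → (∀ a → Q a → P (f a)) →
                   ∀ {a} → P a → ∀ k → P (iter f k a) ⊎ Q (iter f k a)
orbit-alternates f P Q P→Q Q→P a∈P zero = inj₁ a∈P
orbit-alternates f P Q P→Q Q→P a∈P (suc k) with orbit-alternates f P Q P→Q Q→P a∈P k
... | inj₁ p = inj₂ (P→Q _ p)
... | inj₂ q = inj₁ (Q→P _ q)

Constant : ∀ {n s} → ℕ → Conf n s → Set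
Constant c z = ∀ i → toℕ (z i) ≡ c

module Swap (n K w : ℕ) (f : Conf (suc n) (suc K) → Conf (suc n) (suc K)) (f∈F : InF (suc n) (suc K) f)
            (fixes : ∀ x → B (suc n) (suc K) w x → IsFixed f x) (K≤w : K ≤ w) (w≤nK : w ≤ n * K) where

  open Antitone f f∈F

  -- Compare 0 with a point of B whose i-th coordinate is K.
  bottom↦top : ∀ z → Constant 0 z → Constant K (f z)
  bottom↦top z z≡0 i with prescribed i (fromℕ K) (w ∸ K) (≤-trans (m∸n≤m w K) w≤nK)
  ... | y , yi≡K , Wy≡ = ≤-antisym (toℕ≤pred[n] (f z i)) (begin
      K              ≡⟨ sym (toℕ-fromℕ K) ⟩
      toℕ (fromℕ K)  ≡⟨ cong toℕ (sym (trans (fixes y y∈B i) yi≡K)) ⟩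
      toℕ (f y i)    ≤⟨ antitone z y (λ j → subst (_≤ toℕ (y j)) (sym (z≡0 j)) z≤n) i ⟩
      toℕ (f z i)    ∎)
    where
    open ≤-Reasoning
    y∈B : W y ≡ w
    y∈B = trans Wy≡ (trans (cong (_+ (w ∸ K)) (toℕ-fromℕ K)) (m+[n∸m]≡n K≤w))

  -- Compare K with a point of B whose i-th coordinate is 0.
  top↦bottom : ∀ z → Constant K z → Constant 0 (f z)
  top↦bottom z z≡K i with prescribed i Fin.zero w w≤nK
  ... | y , yi≡0 , y∈B = n≤0⇒n≡0 (begin
      toℕ (f z i)    ≤⟨ antitone y z (λ j → subst (toℕ (y j) ≤_) (sym (z≡K j)) (toℕ≤pred[n] (y j))) i ⟩
      toℕ (f y i)    ≡⟨ cong toℕ (trans (fixes y y∈B i) yi≡0) ⟩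
      0              ∎)
    where open ≤-Reasoning

-- The constant configurations 0 and K have weights 0 < K ≤ w and (n+1)K > nK ≥ w.
extremes-not-in-B : ∀ n K w → 0 < K → K ≤ w → w ≤ n * K →
                    ∀ z → Constant 0 z ⊎ Constant K z → ¬ B (suc n) (suc K) w z
extremes-not-in-B n K w 0<K K≤w w≤nK z (inj₁ z≡0) z∈B = <⇒≱ 0<K (begin
    K          ≤⟨ K≤w ⟩
    w          ≡⟨ sym z∈B ⟩
    W z        ≡⟨ W-const z 0 z≡0 ⟩
    suc n * 0  ≡⟨ *-zeroʳ (suc n) ⟩
    0          ∎)
  where open ≤-Reasoning
extremes-not-in-B n K w 0<K K≤w w≤nK z (inj₂ z≡K) z∈B = <⇒≱ (+-monoˡ-< (n * K) 0<K) (begin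
    K + n * K  ≡⟨ sym (W-const z K z≡K) ⟩
    W z        ≡⟨ z∈B ⟩
    w          ≤⟨ w≤nK ⟩
    n * K      ∎)
  where open ≤-Reasoning

-- The core of Part 2, for n+1 coordinates and s = K+1 with K ≥ 1: the orbit of
-- the zero configuration alternates between the two extremes and never meets B.
no-convergence : ∀ n K w → 0 < K → K ≤ w → w ≤ n * K →
                 ∀ f → InF (suc n) (suc K) f → ¬ ConvergesTo f (B (suc n) (suc K) w)
no-convergence n K w 0<K K≤w w≤nK f f∈F (fixes , reaches) =
  extremes-not-in-B n K w 0<K K≤w w≤nK _ (orbit (suc k)) (proj₂ (reaches origin))
  where
  open Swap n K w f f∈F fixes K≤w w≤nK
  origin : Conf (suc n) (suc K)
  origin _ = Fin.zero
  k : ℕ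
  k = proj₁ (reaches origin)
  orbit : ∀ m → Constant 0 (iter f m origin) ⊎ Constant K (iter f m origin)
  orbit = orbit-alternates f (Constant 0) (Constant K) bottom↦top top↦bottom (λ _ → refl)

no-convergence-to-level : ∀ n s w → 1 ≤ n → 2 ≤ s → s ∸ 1 ≤ w → w ≤ (n ∸ 1) * (s ∸ 1) →
                          ∀ f → InF n s f → ¬ ConvergesTo f (B n s w)
no-convergence-to-level (suc n) (suc (suc k)) w _ (s≤s (s≤s _)) = no-convergence n (suc k) w (s≤s z≤n)

middle-above : ∀ m K → K ≤ (suc (suc m) * K) / 2
middle-above m K = begin
    K                     ≡⟨ sym (m*n/n≡m K 2) ⟩
    (K * 2) / 2           ≡⟨ cong (_/ 2) (*-comm K 2) ⟩
    (2 * K) / 2           ≤⟨ /-monoˡ-≤ 2 (*-monoˡ-≤ K {2} {suc (suc m)} (s≤s (s≤s z≤n))) ⟩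
    (suc (suc m) * K) / 2 ∎
  where open ≤-Reasoning

middle-below : ∀ m K → (suc (suc m) * K) / 2 ≤ suc m * K
middle-below m K = begin
    (suc (suc m) * K) / 2 ≤⟨ /-monoˡ-≤ 2 (*-monoˡ-≤ K (s≤s (s≤s (m≤m*n m 2)))) ⟩
    (suc m * 2 * K) / 2   ≡⟨ cong (_/ 2) (*-assoc (suc m) 2 K) ⟩
    (suc m * (2 * K)) / 2 ≡⟨ cong (λ t → (suc m * t) / 2) (*-comm 2 K) ⟩
    (suc m * (K * 2)) / 2 ≡⟨ cong (_/ 2) (sym (*-assoc (suc m) K 2)) ⟩
    (suc m * K * 2) / 2   ≡⟨ m*n/n≡m (suc m * K) 2 ⟩
    suc m * K             ∎
  where open ≤-Reasoning

no-convergence-to-middle : ∀ n s → 2 ≤ n → 2 ≤ s →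
                           ∀ f → InF n s f → ¬ ConvergesTo f (B n s ((n * (s ∸ 1)) / 2))
no-convergence-to-middle (suc (suc m)) s (s≤s (s≤s _)) 2≤s =
  no-convergence-to-level (suc (suc m)) s _ (s≤s z≤n) 2≤s (middle-above m (s ∸ 1)) (middle-below m (s ∸ 1))

saturation-map : ∀ n s w .{{_ : NonZero s}} → 1 ≤ n → 2 ≤ s → w ≤ n * (s ∸ 1) →
                 InF n s (satMap n s w) × (∀ x → IsFixed (satMap n s w) x ⇔ B n s w x)
saturation-map n (suc K) w _ _ w≤nK = sat∈F , λ x → mk⇔ (fixed⇒B w≤nK x) (B⇒fixed x)
  where open SaturationMap n K w

proposition7 :
    (∀ n s w .{{_ : NonZero s}} → 1 ≤ n → 2 ≤ s → w ≤ n * (s ∸ 1) →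
       InF n s (satMap n s w)
       × (∀ x → IsFixed (satMap n s w) x ⇔ B n s w x))
    × (∀ n s w → 1 ≤ n → 2 ≤ s → s ∸ 1 ≤ w → w ≤ (n ∸ 1) * (s ∸ 1) →
         ∀ f → InF n s f → ¬ ConvergesTo f (B n s w))
    × (∀ n s → 2 ≤ n → 2 ≤ s →
         ∀ f → InF n s f → ¬ ConvergesTo f (B n s ((n * (s ∸ 1)) / 2)))
proposition7 = saturation-map , no-convergence-to-level , no-convergence-to-middle
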